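{- In a black-white array with deletions (as defined in the context), a demote operation of the segment of rank $i$ results either (if the segment of rank $i-1$ was inactive) in a new active segment of rank $i-1$ with occupancy rate $100\%$, or (if the segment of rank $i-1$ was active) in a new segment of rank $i$, obtained after the merge with the segment of rank $i-1$, with occupancy rate strictly greater than $75\%$.
   Context: Black-white array (BWA) of size $N=2^K$: values from a totally ordered set are stored in a white array $W$ (indices $1,\dots,N-1$) and a black array $B$ (indices $1,\dots,N/2-1$); the segment of rank $j$ of an array is the index range $[2^j,2^{j+1}-1]$. A state variable $\mathtt{total}$ counts stored entries (a special marker VOID left by a deletion counts as an entry); the segment of rank $i$ is active iff bit $i$ of $\mathtt{total}$ is $1$. In a stable state (after each operation completes) all stored entries lie in active white segments, each sorted ascending (ignoring VOIDs). Insertion: a new value goes to $W[1]$ if rank $0$ is inactive, else to $B[1]$ followed by merge of rank $0$, where merge of rank $i$ merges the black and white segments of rank $i$ into the white segment of rank $i+1$ if that is inactive, and otherwise into the black segment of rank $i+1$ followed by merge of rank $i+1$; then $\mathtt{total}$ increases by one. The occupancy vector $V$ has $V[i]=$ number of non-VOID values in the white segment of rank $i$; the occupancy rate of segment $i$ is $V[i]/2^i$. Delete$(v)$: search for $v$ among the active segments; if found, replace it by VOID and decrement $V[i]$ for its segment rank $i$; if then $V[i]\le 2^{i-1}$ (half the segment length), the segment of rank $i$ is demoted: its non-VOID values (in sorted order) are copied to rank $i-1$. If the segment of rank $i-1$ is inactive they are placed in the white segment of rank $i-1$, which becomes active while rank $i$ becomes inactive. If the segment of rank $i-1$ is active they are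 placed in the black segment of rank $i-1$, and the black and white segments of rank $i-1$ are then merged, the result being put back into the white segment of rank $i$ (rank $i$ stays active, rank $i-1$ becomes inactive, and $V$, $\mathtt{total}$ are updated accordingly). -}

module Defs where

open import Level using (Level)
open import Data.Nat using (ℕ; zero; suc; _+_; _*_; _∸_; _^_; _≤_; _<_; _%_; _/_; _≡ᵇ_)
open import Data.Bool using (Bool; true; false; if_then_else_)
open import Data.Maybe using (Maybe; just; nothing)
open import Data.List using (List; []; _∷_)
open import Relation.Binary.Bundles using (DecTotalOrder)
open import Relation.Binary.PropositionalEquality using (_≡_)
open import Relation.Nullary using (yes; no; does)

bit : ℕ → ℕ → Bool
bit zero    n = n % 2 ≡ᵇ 1
bit (suc i) n = bit i (n / 2)

-- Black-white array with deletions over the totally ordered set O, of size N = 2 ^ K.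
module BWA {a ℓ₁ ℓ₂ : Level} (O : DecTotalOrder a ℓ₁ ℓ₂) (K : ℕ) where
  open DecTotalOrder O using (Carrier; _≈_; _≤?_)

  -- an array cell: just x is a stored value, nothing is the VOID marker
  Entry : Set a
  Entry = Maybe Carrier

  -- W r is the content of the white segment of rank r (indices 2^r .. 2^(r+1)-1);
  -- black segments only exist transiently inside insert/demote.
  record State : Set a where
    constructor mkState
    field
      total : ℕ
      W     : ℕ → List Entry
  open State public

  active : State → ℕ → Bool
  active s i = bit i (total s)

  count : List Entry → ℕ
  count []             = 0
  count (nothing ∷ xs) = count xs
  count (just _ ∷ xs)  = suc (count xs)

  V : State → ℕ → ℕ
  V s i = count (W s i)

  values : List Entry → List Entry
  values []             = []
  values (nothing ∷ xs) = values xs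
  values (just x ∷ xs)  = just x ∷ values xs

  merge : List Entry → List Entry → List Entry
  merge [] ys = ys
  merge xs@(_ ∷ _) [] = xs
  merge (nothing ∷ xs) ys = nothing ∷ merge xs ys
  merge xs@(just _ ∷ _) (nothing ∷ ys) = nothing ∷ merge xs ys
  merge xs₀@(just x ∷ xs) ys₀@(just y ∷ ys) =
    if does (x ≤? y) then just x ∷ merge xs ys₀ else just y ∷ merge xs₀ ys

  upd : (ℕ → List Entry) → ℕ → List Entry → (ℕ → List Entry)
  upd w i l j = if j ≡ᵇ i then l else w j

  -- merge cascade of insertion: carry c (black segment of rank r, merged with
  -- the white one of rank r - 1) arrives at rank r; t is the old total.
  cascade : ℕ → ℕ → List Entry → ℕ → (ℕ → List Entry) → (ℕ → List Entry)
  cascade zero       r c t w = w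
  cascade (suc fuel) r c t w with bit r t
  ... | false = upd w r c
  ... | true  = cascade fuel (suc r) (merge c (w r)) t (upd w r [])

  insert : Carrier → State → State
  insert v s with bit 0 (total s)
  ... | false = mkState (suc (total s)) (upd (W s) 0 (just v ∷ []))
  ... | true  = mkState (suc (total s))
                  (cascade K 1 (merge (just v ∷ []) (W s 0)) (total s) (upd (W s) 0 []))

  lookupAt : List Entry → ℕ → Maybe Entry
  lookupAt []       _       = nothing
  lookupAt (x ∷ xs) zero    = just x
  lookupAt (x ∷ xs) (suc p) = lookupAt xs p

  voidList : List Entry → ℕ → List Entry
  voidList []       _       = []
  voidList (x ∷ xs) zero    = nothing ∷ xs
  voidList (x ∷ xs) (suc p) = x ∷ voidList xs p

  voidAt : State → ℕ → ℕ → State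
  voidAt s i p = mkState (total s) (upd (W s) i (voidList (W s i) p))

  demote : State → ℕ → State
  demote s zero    = mkState (total s ∸ 1) (upd (W s) 0 [])
  demote s (suc j) with bit j (total s)
  ... | false = mkState (total s ∸ 2 ^ j)
                  (upd (upd (W s) (suc j) []) j (values (W s (suc j))))
  ... | true  = mkState (total s ∸ 2 ^ j)
                  (upd (upd (W s) j []) (suc j) (merge (values (W s (suc j))) (W s j)))

  deleteAt : State → ℕ → ℕ → State
  deleteAt s i p with 2 * V (voidAt s i p) i Data.Nat.≤ᵇ 2 ^ i
  ... | true  = demote (voidAt s i p) i
  ... | false = voidAt s i p

  empty : State
  empty = mkState 0 (λ _ → [])

  data Reachable : State → Set (a Level.⊔ ℓ₁) where
    init : Reachable empty
    ins  : ∀ {s} (v : Carrier) → suc (total s) < 2 ^ K → Reachable s → Reachable (insert v s)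
    del  : ∀ {s} (v x : Carrier) (i p : ℕ) → Reachable s → active s i ≡ true →
           lookupAt (W s i) p ≡ just (just x) → x ≈ v → Reachable (deleteAt s i p)

-- Every reachable state keeps each active segment of rank i more than half full,
-- 2 ^ i < 2 * V[i]: an insertion merges such segments (and the new value) into the
-- segment of the next rank, and a deletion either leaves its segment above half or
-- demotes it. So rank j + 1 is demoted exactly when its occupancy drops from 2 ^ j + 1
-- to 2 ^ j. Moving these 2 ^ j values into an inactive rank j fills it completely;
-- merging them with an active rank j, itself more than half full, yields more than
-- 2 ^ j + 2 ^ j / 2 values, i.e. more than 3/4 of 2 ^ (j + 1).
module Submission where

open import Defs
open import Level using (Level)
open import Data.Nat
open import Data.Nat.Properties
open import Data.Nat.DivMod
open import Data.Nat.Divisibility using (divides)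
open import Data.Nat.Tactic.RingSolver using (solve-∀)
open import Data.Bool using (true; false; T)
import Data.Bool as Bool
open import Data.Bool.Properties using (¬-not)
open import Data.Empty using (⊥-elim)
open import Data.Maybe using (just; nothing)
open import Data.List using (List; []; _∷_)
open import Data.Product using (∃; _×_; _,_)
open import Data.Sum using (_⊎_; inj₁; inj₂)
open import Function using (_∘_)
open import Relation.Nullary using (yes; no; does; contradiction)
open import Relation.Binary.Bundles using (DecTotalOrder)
open import Relation.Binary.PropositionalEquality

data EvenOdd : ℕ → Set where
  even : ∀ q → EvenOdd (q * 2)
  odd  : ∀ q → EvenOdd (suc (q * 2))

evenOdd : ∀ n → EvenOdd n
evenOdd zero = even 0
evenOdd (suc n) with evenOdd n
... | even q = odd q
... | odd q  = even (suc q)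

bit-even-zero : ∀ q → bit 0 (q * 2) ≡ false
bit-even-zero q = cong (_≡ᵇ 1) (m*n%n≡0 q 2)

bit-odd-zero : ∀ q → bit 0 (suc (q * 2)) ≡ true
bit-odd-zero q = cong (_≡ᵇ 1) ([m+kn]%n≡m%n 1 q 2)

bit-even-suc : ∀ k q → bit (suc k) (q * 2) ≡ bit k q
bit-even-suc k q = cong (bit k) (m*n/n≡m q 2)

bit-odd-suc : ∀ k q → bit (suc k) (suc (q * 2)) ≡ bit k q
bit-odd-suc k q = cong (bit k) (trans (+-distrib-/-∣ʳ 1 {d = 2} (divides q refl)) (m*n/n≡m q 2))

2^[1+n]≡2^n*2 : ∀ n → 2 ^ suc n ≡ 2 ^ n * 2
2^[1+n]≡2^n*2 n = *-comm 2 (2 ^ n)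

bit0-[m+2^[1+n]] : ∀ m n → bit 0 (m + 2 ^ suc n) ≡ bit 0 m
bit0-[m+2^[1+n]] m n =
  cong (_≡ᵇ 1) (trans (cong (λ x → (m + x) % 2) (2^[1+n]≡2^n*2 n)) ([m+kn]%n≡m%n m (2 ^ n) 2))

[m+2^[1+n]]/2≡m/2+2^n : ∀ m n → (m + 2 ^ suc n) / 2 ≡ m / 2 + 2 ^ n
[m+2^[1+n]]/2≡m/2+2^n m n = begin
  (m + 2 ^ suc n) / 2       ≡⟨ +-distrib-/-∣ʳ m (divides (2 ^ n) (2^[1+n]≡2^n*2 n)) ⟩
  m / 2 + 2 ^ suc n / 2     ≡⟨ cong (λ x → m / 2 + x / 2) (2^[1+n]≡2^n*2 n) ⟩
  m / 2 + 2 ^ n * 2 / 2     ≡⟨ cong (m / 2 +_) (m*n/n≡m (2 ^ n) 2) ⟩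
  m / 2 + 2 ^ n             ∎
  where open ≡-Reasoning

bit-set : ∀ j u → bit j u ≡ false → bit j (u + 2 ^ j) ≡ true
bit-set zero u u₀≡0 with evenOdd u
... | even q = trans (cong (bit 0) (+-comm (q * 2) 1)) (bit-odd-zero q)
... | odd q  = contradiction (trans (sym (bit-odd-zero q)) u₀≡0) λ ()
bit-set (suc j) u uⱼ≡0 = trans (cong (bit j) ([m+2^[1+n]]/2≡m/2+2^n u j)) (bit-set j (u / 2) uⱼ≡0)

bit-set-≢ : ∀ j k u → bit j u ≡ false → k ≢ j → bit k (u + 2 ^ j) ≡ bit k u
bit-set-≢ zero zero u _ k≢j = contradiction refl k≢j
bit-set-≢ zero (suc k) u u₀≡0 _ with evenOdd u
... | even q =
  trans (cong (bit (suc k)) (+-comm (q * 2) 1)) (trans (bit-odd-suc k q) (sym (bit-even-suc k q)))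
... | odd q  = contradiction (trans (sym (bit-odd-zero q)) u₀≡0) λ ()
bit-set-≢ (suc j) zero u _ _ = bit0-[m+2^[1+n]] u j
bit-set-≢ (suc j) (suc k) u uⱼ≡0 k≢j =
  trans (cong (bit k) ([m+2^[1+n]]/2≡m/2+2^n u j)) (bit-set-≢ j k (u / 2) uⱼ≡0 (k≢j ∘ cong suc))

[m+2^n]*2≡m*2+2^[1+n] : ∀ m n → (m + 2 ^ n) * 2 ≡ m * 2 + 2 ^ suc n
[m+2^n]*2≡m*2+2^[1+n] m n = trans (*-distribʳ-+ 2 m (2 ^ n)) (cong (m * 2 +_) (sym (2^[1+n]≡2^n*2 n)))

bit⇒≡clear+2^ : ∀ j t → bit j t ≡ true → ∃ λ u → bit j u ≡ false × t ≡ u + 2 ^ j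
bit⇒≡clear+2^ zero t tⱼ≡1 with evenOdd t
... | even q = contradiction (trans (sym (bit-even-zero q)) tⱼ≡1) λ ()
... | odd q  = q * 2 , bit-even-zero q , +-comm 1 (q * 2)
bit⇒≡clear+2^ (suc j) t tⱼ≡1 with evenOdd t
... | even q with bit⇒≡clear+2^ j q (trans (sym (bit-even-suc j q)) tⱼ≡1)
...   | u , uⱼ≡0 , refl = u * 2 , trans (bit-even-suc j u) uⱼ≡0 , [m+2^n]*2≡m*2+2^[1+n] u j
bit⇒≡clear+2^ (suc j) t tⱼ≡1 | odd q with bit⇒≡clear+2^ j q (trans (sym (bit-odd-suc j q)) tⱼ≡1)
...   | u , uⱼ≡0 , refl = suc (u * 2) , trans (bit-odd-suc j u) uⱼ≡0 , cong suc ([m+2^n]*2≡m*2+2^[1+n] u j)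

bit⇒2^≤ : ∀ j t → bit j t ≡ true → 2 ^ j ≤ t
bit⇒2^≤ j t tⱼ≡1 with bit⇒≡clear+2^ j t tⱼ≡1
... | u , _ , refl = m≤n+m (2 ^ j) u

<2^⇒bit≡false : ∀ j t → t < 2 ^ j → bit j t ≡ false
<2^⇒bit≡false j t t<2^j with bit j t in tⱼ
... | false = refl
... | true  = contradiction (bit⇒2^≤ j t tⱼ) (<⇒≱ t<2^j)

bit-clear : ∀ j t → bit j t ≡ true → bit j (t ∸ 2 ^ j) ≡ false
bit-clear j t tⱼ≡1 with bit⇒≡clear+2^ j t tⱼ≡1
... | u , uⱼ≡0 , refl = trans (cong (bit j) (m+n∸n≡m u (2 ^ j))) uⱼ≡0

bit-clear-≢ : ∀ j k t → bit j t ≡ true → k ≢ j → bit k (t ∸ 2 ^ j) ≡ bit k t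
bit-clear-≢ j k t tⱼ≡1 k≢j with bit⇒≡clear+2^ j t tⱼ≡1
... | u , uⱼ≡0 , refl = trans (cong (bit k) (m+n∸n≡m u (2 ^ j))) (sym (bit-set-≢ j k u uⱼ≡0 k≢j))

borrow : ∀ j t → 2 ^ suc j ≤ t → t ∸ 2 ^ j ≡ (t ∸ 2 ^ suc j) + 2 ^ j
borrow j t 2^[1+j]≤t = begin
  t ∸ 2 ^ j                                ≡⟨ cong (_∸ 2 ^ j) (sym (m∸n+n≡m 2^[1+j]≤t)) ⟩
  (t ∸ 2 ^ suc j) + 2 ^ suc j ∸ 2 ^ j      ≡⟨ cong (λ x → (t ∸ 2 ^ suc j) + (2 ^ j + x) ∸ 2 ^ j) (+-identityʳ (2 ^ j)) ⟩
  (t ∸ 2 ^ suc j) + (2 ^ j + 2 ^ j) ∸ 2 ^ j ≡⟨ cong (_∸ 2 ^ j) (sym (+-assoc (t ∸ 2 ^ suc j) (2 ^ j) (2 ^ j))) ⟩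
  (t ∸ 2 ^ suc j) + 2 ^ j + 2 ^ j ∸ 2 ^ j   ≡⟨ m+n∸n≡m _ (2 ^ j) ⟩
  (t ∸ 2 ^ suc j) + 2 ^ j                  ∎
  where open ≡-Reasoning

bit-carry : ∀ r t → (∀ i → i < r → bit i t ≡ true) → bit r t ≡ false →
            ∀ i → bit i (suc t) ≡ true → i ≡ r ⊎ (r < i × bit i t ≡ true)
bit-carry zero t _ _ zero _ = inj₁ refl
bit-carry zero t _ t₀≡0 (suc i) [1+t]ᵢ with evenOdd t
... | even q = inj₂ (s≤s z≤n , trans (bit-even-suc i q) (trans (sym (bit-odd-suc i q)) [1+t]ᵢ))
... | odd q  = contradiction (trans (sym (bit-odd-zero q)) t₀≡0) λ ()
bit-carry (suc r) t low tᵣ≡0 i [1+t]ᵢ with evenOdd t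
... | even q = contradiction (trans (sym (bit-even-zero q)) (low 0 (s≤s z≤n))) λ ()
bit-carry (suc r) t low tᵣ≡0 zero [1+t]ᵢ | odd q = contradiction (trans (sym (bit-even-zero (suc q))) [1+t]ᵢ) λ ()
bit-carry (suc r) t low tᵣ≡0 (suc i) [1+t]ᵢ | odd q
  with bit-carry r q (λ k k<r → trans (sym (bit-odd-suc k q)) (low (suc k) (s≤s k<r)))
                     (trans (sym (bit-odd-suc r q)) tᵣ≡0) i (trans (sym (bit-even-suc i (suc q))) [1+t]ᵢ)
... | inj₁ i≡r        = inj₁ (cong suc i≡r)
... | inj₂ (r<i , qᵢ) = inj₂ (s≤s r<i , trans (bit-odd-suc i q) qᵢ)

-- Subtracting 2 ^ j from t borrows from bit j + 1: clear that bit, then set bit j.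
module _ (j t : ℕ) (tⱼ≡0 : bit j t ≡ false) (t₁₊ⱼ≡1 : bit (suc j) t ≡ true) where
  private
    t∸2^j≡ : t ∸ 2 ^ j ≡ (t ∸ 2 ^ suc j) + 2 ^ j
    t∸2^j≡ = borrow j t (bit⇒2^≤ (suc j) t t₁₊ⱼ≡1)

    cleared : bit j (t ∸ 2 ^ suc j) ≡ false
    cleared = trans (bit-clear-≢ (suc j) j t t₁₊ⱼ≡1 (≢-sym 1+n≢n)) tⱼ≡0

  bit-borrow-self : bit j (t ∸ 2 ^ j) ≡ true
  bit-borrow-self = trans (cong (bit j) t∸2^j≡) (bit-set j _ cleared)

  bit-borrow-suc : bit (suc j) (t ∸ 2 ^ j) ≡ false
  bit-borrow-suc = begin
    bit (suc j) (t ∸ 2 ^ j)                 ≡⟨ cong (bit (suc j)) t∸2^j≡ ⟩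
    bit (suc j) ((t ∸ 2 ^ suc j) + 2 ^ j)   ≡⟨ bit-set-≢ j (suc j) _ cleared 1+n≢n ⟩
    bit (suc j) (t ∸ 2 ^ suc j)             ≡⟨ bit-clear (suc j) t t₁₊ⱼ≡1 ⟩
    false                                   ∎
    where open ≡-Reasoning

  bit-borrow-≢ : ∀ k → k ≢ j → k ≢ suc j → bit k (t ∸ 2 ^ j) ≡ bit k t
  bit-borrow-≢ k k≢j k≢1+j = begin
    bit k (t ∸ 2 ^ j)                 ≡⟨ cong (bit k) t∸2^j≡ ⟩
    bit k ((t ∸ 2 ^ suc j) + 2 ^ j)   ≡⟨ bit-set-≢ j k _ cleared k≢j ⟩
    bit k (t ∸ 2 ^ suc j)             ≡⟨ bit-clear-≢ (suc j) k t t₁₊ⱼ≡1 k≢1+j ⟩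
    bit k t                           ∎
    where open ≡-Reasoning

2^n<2*2^n : ∀ n → 2 ^ n < 2 * 2 ^ n
2^n<2*2^n n = subst (2 ^ n <_) (*-comm (2 ^ n) 2) (m<m*n (2 ^ n) 2 ≤-refl)
  where instance _ = m^n≢0 2 n

m<2a⇒m<2b⇒2m<2[a+b] : ∀ {m} a b → m < 2 * a → m < 2 * b → 2 * m < 2 * (a + b)
m<2a⇒m<2b⇒2m<2[a+b] {m} a b m<2a m<2b =
  subst₂ _<_ (cong (m +_) (sym (+-identityʳ m))) (sym (*-distribˡ-+ 2 a b)) (+-mono-< m<2a m<2b)

m<2n⇒6m<4[m+n] : ∀ m n → m < 2 * n → 3 * (2 * m) < 4 * (m + n)
m<2n⇒6m<4[m+n] m n m<2n =
  subst₂ _<_ (6m≡ m) (sym (*-distribˡ-+ 4 m n))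
    (+-monoʳ-< (4 * m) (subst (2 * m <_) (4n≡ n) (*-monoʳ-< 2 m<2n)))
  where
    6m≡ : ∀ m → 4 * m + 2 * m ≡ 3 * (2 * m)
    6m≡ = solve-∀
    4n≡ : ∀ n → 2 * (2 * n) ≡ 4 * n
    4n≡ = solve-∀

2c≤2^[1+j]<2[1+c]⇒c≡2^j : ∀ j c → 2 * c ≤ 2 ^ suc j → 2 ^ suc j < 2 * suc c → c ≡ 2 ^ j
2c≤2^[1+j]<2[1+c]⇒c≡2^j j c 2c≤ <2[1+c] = ≤-antisym (*-cancelˡ-≤ 2 2c≤) (s≤s⁻¹ (*-cancelˡ-< 2 _ _ <2[1+c]))

module Occupancy {a ℓ₁ ℓ₂ : Level} (O : DecTotalOrder a ℓ₁ ℓ₂) (K : ℕ) where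
  open BWA O K
  open DecTotalOrder O using () renaming (_≤?_ to _≼?_)

  upd-≡ : ∀ (w : ℕ → List Entry) i l → upd w i l i ≡ l
  upd-≡ w i l with i ≡ᵇ i in eq
  ... | true  = refl
  ... | false = ⊥-elim (subst T eq (≡⇒≡ᵇ i i refl))

  upd-≢ : ∀ (w : ℕ → List Entry) i l {k} → k ≢ i → upd w i l k ≡ w k
  upd-≢ w i l {k} k≢i with k ≡ᵇ i in eq
  ... | false = refl
  ... | true  = contradiction (≡ᵇ⇒≡ k i (subst T (sym eq) _)) k≢i

  count-merge : ∀ xs ys → count (merge xs ys) ≡ count xs + count ys
  count-merge [] ys = refl
  count-merge (x ∷ xs) [] = sym (+-identityʳ _)
  count-merge (nothing ∷ xs) (y ∷ ys) = count-merge xs (y ∷ ys)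
  count-merge (just x ∷ xs) (nothing ∷ ys) = count-merge (just x ∷ xs) ys
  count-merge (just x ∷ xs) (just y ∷ ys)
    with does (x ≼? y) | count-merge xs (just y ∷ ys) | count-merge (just x ∷ xs) ys
  ... | true  | takeˡ | _     = cong suc takeˡ
  ... | false | _     | takeʳ = cong suc (trans takeʳ (sym (+-suc (count xs) (count ys))))

  count-values : ∀ xs → count (values xs) ≡ count xs
  count-values [] = refl
  count-values (nothing ∷ xs) = count-values xs
  count-values (just x ∷ xs) = cong suc (count-values xs)

  count-voidList : ∀ xs p {x} → lookupAt xs p ≡ just (just x) → suc (count (voidList xs p)) ≡ count xs
  count-voidList (just _ ∷ xs)  zero    _     = refl
  count-voidList (nothing ∷ xs) (suc p) found = count-voidList xs p found
  count-voidList (just _ ∷ xs)  (suc p) found = cong suc (count-voidList xs p found)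

  HalfFull : State → ℕ → Set
  HalfFull s i = active s i ≡ true → 2 ^ i < 2 * V s i

  record Invariant (s : State) : Set where
    constructor invariant
    field
      halfFull : ∀ i → HalfFull s i
      bounded  : total s < 2 ^ K  -- keeps the insertion cascade within its fuel K
  open Invariant public

  inactive⇒HalfFull : ∀ s i → active s i ≡ false → HalfFull s i
  inactive⇒HalfFull _ _ off on = contradiction (trans (sym on) off) λ ()

  HalfFull-resp : ∀ s s′ i → active s′ i ≡ active s i → W s′ i ≡ W s i → HalfFull s i → HalfFull s′ i
  HalfFull-resp _ _ i act≡ W≡ half on =
    subst (λ l → 2 ^ i < 2 * count l) (sym W≡) (half (trans (sym act≡) on))

  invariant-empty : Invariant empty
  invariant-empty = invariant (λ i → inactive⇒HalfFull empty i (<2^⇒bit≡false i 0 (m^n>0 2 i))) (m^n>0 2 K)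

  -- A clear bit n below r + fuel stops the carry before the fuel runs out.
  cascade-halfFull : ∀ fuel r c t w {n} →
    (∀ i → i < r → bit i t ≡ true) → 2 ^ r < 2 * count c →
    (∀ i → r ≤ i → bit i t ≡ true → 2 ^ i < 2 * count (w i)) →
    bit n t ≡ false → n < r + fuel →
    ∀ i → bit i (suc t) ≡ true → 2 ^ i < 2 * count (cascade fuel r c t w i)
  cascade-halfFull zero r c t w {n} low _ _ tₙ≡0 n<r _ _ =
    contradiction (trans (sym (low n (subst (n <_) (+-identityʳ r) n<r))) tₙ≡0) λ ()
  cascade-halfFull (suc fuel) r c t w {n} low c-half w-half tₙ≡0 n<r+fuel i [1+t]ᵢ with bit r t in tᵣ
  ... | false with bit-carry r t low tᵣ i [1+t]ᵢ
  ...   | inj₁ refl = subst (λ l → 2 ^ r < 2 * count l) (sym (upd-≡ w r c)) c-half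
  ...   | inj₂ (r<i , tᵢ) =
    subst (λ l → 2 ^ i < 2 * count l) (sym (upd-≢ w r c (>⇒≢ r<i))) (w-half i (<⇒≤ r<i) tᵢ)
  cascade-halfFull (suc fuel) r c t w {n} low c-half w-half tₙ≡0 n<r+fuel i [1+t]ᵢ | true =
    cascade-halfFull fuel (suc r) (merge c (w r)) t (upd w r []) low′ merged-half w-half′ tₙ≡0
                     (subst (n <_) (+-suc r fuel) n<r+fuel) i [1+t]ᵢ
    where
      low′ : ∀ i → i < suc r → bit i t ≡ true
      low′ i i<1+r with m≤n⇒m<n∨m≡n (s≤s⁻¹ i<1+r)
      ... | inj₁ i<r  = low i i<r
      ... | inj₂ refl = tᵣ
      merged-half : 2 ^ suc r < 2 * count (merge c (w r))
      merged-half = subst (λ m → 2 ^ suc r < 2 * m) (sym (count-merge c (w r)))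
                          (m<2a⇒m<2b⇒2m<2[a+b] (count c) (count (w r)) c-half (w-half r ≤-refl tᵣ))
      w-half′ : ∀ i → suc r ≤ i → bit i t ≡ true → 2 ^ i < 2 * count (upd w r [] i)
      w-half′ i r<i tᵢ =
        subst (λ l → 2 ^ i < 2 * count l) (sym (upd-≢ w r [] (>⇒≢ r<i))) (w-half i (<⇒≤ r<i) tᵢ)

  insert≡cascade : ∀ v s →
    insert v s ≡ mkState (suc (total s)) (cascade (suc K) 0 (just v ∷ []) (total s) (W s))
  insert≡cascade v s with bit 0 (total s)
  ... | false = refl
  ... | true  = refl

  invariant-insert : ∀ v s → suc (total s) < 2 ^ K → Invariant s → Invariant (insert v s)
  invariant-insert v s bound inv = subst Invariant (sym (insert≡cascade v s)) (invariant half bound)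
    where
      half : ∀ i → bit i (suc (total s)) ≡ true →
             2 ^ i < 2 * count (cascade (suc K) 0 (just v ∷ []) (total s) (W s) i)
      half = cascade-halfFull (suc K) 0 (just v ∷ []) (total s) (W s) (λ _ ()) ≤-refl (λ i _ → halfFull inv i)
                              (<2^⇒bit≡false K (total s) (bounded inv)) (n<1+n K)

  total-demote : ∀ s j → total (demote s (suc j)) ≡ total s ∸ 2 ^ j
  total-demote s j with bit j (total s)
  ... | false = refl
  ... | true  = refl

  active-demote : ∀ s j k → active (demote s (suc j)) k ≡ bit k (total s ∸ 2 ^ j)
  active-demote s j k = cong (bit k) (total-demote s j)

  W-demote-≢ : ∀ s j {k} → k ≢ j → k ≢ suc j → W (demote s (suc j)) k ≡ W s k
  W-demote-≢ s j k≢j k≢1+j with bit j (total s)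
  ... | false = trans (upd-≢ (upd (W s) (suc j) []) j (values (W s (suc j))) k≢j)
                      (upd-≢ (W s) (suc j) [] k≢1+j)
  ... | true  = trans (upd-≢ (upd (W s) j []) (suc j) (merge (values (W s (suc j))) (W s j)) k≢1+j)
                      (upd-≢ (W s) j [] k≢j)

  V-demote-inactive : ∀ s j → active s j ≡ false → V (demote s (suc j)) j ≡ V s (suc j)
  V-demote-inactive s j off rewrite off =
    trans (cong count (upd-≡ (upd (W s) (suc j) []) j (values (W s (suc j))))) (count-values (W s (suc j)))

  V-demote-active : ∀ s j → active s j ≡ true → V (demote s (suc j)) (suc j) ≡ V s (suc j) + V s j
  V-demote-active s j on rewrite on = begin
    count (upd (upd (W s) j []) (suc j) merged (suc j)) ≡⟨ cong count (upd-≡ (upd (W s) j []) (suc j) merged) ⟩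
    count merged                                        ≡⟨ count-merge (values (W s (suc j))) (W s j) ⟩
    count (values (W s (suc j))) + V s j                ≡⟨ cong (_+ V s j) (count-values (W s (suc j))) ⟩
    V s (suc j) + V s j                                 ∎
    where
      open ≡-Reasoning
      merged = merge (values (W s (suc j))) (W s j)

  active-demote-inactive : ∀ s j → active s j ≡ false → active s (suc j) ≡ true →
                           active (demote s (suc j)) j ≡ true
  active-demote-inactive s j off on = trans (active-demote s j j) (bit-borrow-self j (total s) off on)

  demote-active-occupancy : ∀ s j → active s j ≡ true → V s (suc j) ≡ 2 ^ j → 2 ^ j < 2 * V s j →
                            3 * 2 ^ suc j < 4 * V (demote s (suc j)) (suc j)
  demote-active-occupancy s j on V≡2^j half =
    subst (λ m → 3 * 2 ^ suc j < 4 * m) (sym (trans (V-demote-active s j on) (cong (_+ V s j) V≡2^j)))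
          (m<2n⇒6m<4[m+n] (2 ^ j) (V s j) half)

  module _ (s : State) (j : ℕ) (on : active s (suc j) ≡ true) (V≡2^j : V s (suc j) ≡ 2 ^ j)
           (half : ∀ k → k ≢ suc j → HalfFull s k) where

    halfFull-demote-inactive : active s j ≡ false → ∀ k → HalfFull (demote s (suc j)) k
    halfFull-demote-inactive off k with k ≟ j | k ≟ suc j
    ... | yes refl | _        = λ _ →
      subst (λ m → 2 ^ j < 2 * m) (sym (trans (V-demote-inactive s j off) V≡2^j)) (2^n<2*2^n j)
    ... | no _     | yes refl = inactive⇒HalfFull (demote s (suc j)) (suc j)
      (trans (active-demote s j (suc j)) (bit-borrow-suc j (total s) off on))
    ... | no k≢j   | no k≢1+j = HalfFull-resp s (demote s (suc j)) k
      (trans (active-demote s j k) (bit-borrow-≢ j (total s) off on k k≢j k≢1+j))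
      (W-demote-≢ s j k≢j k≢1+j) (half k k≢1+j)

    halfFull-demote-active : active s j ≡ true → ∀ k → HalfFull (demote s (suc j)) k
    halfFull-demote-active onⱼ k with k ≟ j | k ≟ suc j
    ... | yes refl | _        = inactive⇒HalfFull (demote s (suc j)) j
      (trans (active-demote s j j) (bit-clear j (total s) onⱼ))
    ... | no _     | yes refl = λ _ →
      subst (λ m → 2 ^ suc j < 2 * m) (sym (V-demote-active s j onⱼ))
            (m<2a⇒m<2b⇒2m<2[a+b] (V s (suc j)) (V s j)
              (subst (λ m → 2 ^ j < 2 * m) (sym V≡2^j) (2^n<2*2^n j)) (half j (≢-sym 1+n≢n) onⱼ))
    ... | no k≢j   | no k≢1+j = HalfFull-resp s (demote s (suc j)) k
      (trans (active-demote s j k) (bit-clear-≢ j k (total s) onⱼ k≢j))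
      (W-demote-≢ s j k≢j k≢1+j) (half k k≢1+j)

    halfFull-demote : ∀ k → HalfFull (demote s (suc j)) k
    halfFull-demote with active s j Bool.≟ true
    ... | yes onⱼ = halfFull-demote-active onⱼ
    ... | no offⱼ = halfFull-demote-inactive (¬-not offⱼ)

  V-voidAt : ∀ s i p {x} → lookupAt (W s i) p ≡ just (just x) → suc (V (voidAt s i p) i) ≡ V s i
  V-voidAt s i p found = trans (cong (suc ∘ count) (upd-≡ (W s) i _)) (count-voidList (W s i) p found)

  halfFull-voidAt-≢ : ∀ s i p {k} → HalfFull s k → k ≢ i → HalfFull (voidAt s i p) k
  halfFull-voidAt-≢ s i p {k} half k≢i = HalfFull-resp s (voidAt s i p) k refl (upd-≢ (W s) i _ k≢i) half

  V-voidAt-demoted : ∀ s j p {x} → HalfFull s (suc j) → active s (suc j) ≡ true →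
                     lookupAt (W s (suc j)) p ≡ just (just x) →
                     2 * V (voidAt s (suc j) p) (suc j) ≤ 2 ^ suc j → V (voidAt s (suc j) p) (suc j) ≡ 2 ^ j
  V-voidAt-demoted s j p half on found ≤half =
    2c≤2^[1+j]<2[1+c]⇒c≡2^j j _ ≤half
      (subst (λ m → 2 ^ suc j < 2 * m) (sym (V-voidAt s (suc j) p found)) (half on))

  invariant-voidAt : ∀ s i p → Invariant s → 2 ^ i < 2 * V (voidAt s i p) i → Invariant (voidAt s i p)
  invariant-voidAt s i p inv >half = invariant half (bounded inv)
    where
      half : ∀ k → HalfFull (voidAt s i p) k
      half k with k ≟ i
      ... | yes refl = λ _ → >half
      ... | no k≢i   = halfFull-voidAt-≢ s i p (halfFull inv k) k≢i

  invariant-demote : ∀ s i p {x} → Invariant s → active s i ≡ true → lookupAt (W s i) p ≡ just (just x) →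
                     2 * V (voidAt s i p) i ≤ 2 ^ i → Invariant (demote (voidAt s i p) i)
  invariant-demote s zero p inv on _ _ = invariant half (≤-<-trans (m∸n≤m (total s) 1) (bounded inv))
    where
      half : ∀ k → HalfFull (demote (voidAt s 0 p) 0) k
      half zero    = inactive⇒HalfFull (demote (voidAt s 0 p) 0) 0 (bit-clear 0 (total s) on)
      half (suc k) = HalfFull-resp s (demote (voidAt s 0 p) 0) (suc k)
        (bit-clear-≢ 0 (suc k) (total s) on λ ())
        (trans (upd-≢ (W (voidAt s 0 p)) 0 [] {suc k} λ ()) (upd-≢ (W s) 0 (voidList (W s 0) p) {suc k} λ ()))
        (halfFull inv (suc k))
  invariant-demote s (suc j) p inv on found ≤half = invariant
    (halfFull-demote s′ j on (V-voidAt-demoted s j p (halfFull inv (suc j)) on found ≤half)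
                     (λ k → halfFull-voidAt-≢ s (suc j) p (halfFull inv k)))
    (subst (_< 2 ^ K) (sym (total-demote s′ j)) (≤-<-trans (m∸n≤m (total s) (2 ^ j)) (bounded inv)))
    where s′ = voidAt s (suc j) p

  invariant-deleteAt : ∀ s i p {x} → Invariant s → active s i ≡ true → lookupAt (W s i) p ≡ just (just x) →
                       Invariant (deleteAt s i p)
  invariant-deleteAt s i p inv on found with 2 * V (voidAt s i p) i ≤ᵇ 2 ^ i in test
  ... | true  = invariant-demote s i p inv on found (≤ᵇ⇒≤ _ _ (subst T (sym test) _))
  ... | false = invariant-voidAt s i p inv (≰⇒> (subst T test ∘ ≤⇒≤ᵇ))

  reachable⇒invariant : ∀ {s} → Reachable s → Invariant s
  reachable⇒invariant init                       = invariant-empty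
  reachable⇒invariant (ins v bound r)            = invariant-insert v _ bound (reachable⇒invariant r)
  reachable⇒invariant (del _ _ i p r on found _) = invariant-deleteAt _ i p (reachable⇒invariant r) on found

mainTheorem3 : ∀ {a ℓ₁ ℓ₂} (O : DecTotalOrder a ℓ₁ ℓ₂) (K : ℕ) →
    let open BWA O K in
    (s : State) → Reachable s →
    (v x : DecTotalOrder.Carrier O) (j p : ℕ) →
    active s (suc j) ≡ true →
    lookupAt (W s (suc j)) p ≡ just (just x) → DecTotalOrder._≈_ O x v →
    2 * V (voidAt s (suc j) p) (suc j) ≤ 2 ^ suc j →
    (active s j ≡ false →
       active (demote (voidAt s (suc j) p) (suc j)) j ≡ true
       × V (demote (voidAt s (suc j) p) (suc j)) j ≡ 2 ^ j)
    × (active s j ≡ true →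
       3 * 2 ^ suc j < 4 * V (demote (voidAt s (suc j) p) (suc j)) (suc j))
mainTheorem3 O K s r _ _ j p on found _ ≤half = into-inactive , into-active
  where
    open BWA O K
    open Occupancy O K
    inv = reachable⇒invariant r
    s′ = voidAt s (suc j) p

    V≡2^j : V s′ (suc j) ≡ 2 ^ j
    V≡2^j = V-voidAt-demoted s j p (halfFull inv (suc j)) on found ≤half

    into-inactive : active s j ≡ false →
                    active (demote s′ (suc j)) j ≡ true × V (demote s′ (suc j)) j ≡ 2 ^ j
    into-inactive off = active-demote-inactive s′ j off on , trans (V-demote-inactive s′ j off) V≡2^j

    into-active : active s j ≡ true → 3 * 2 ^ suc j < 4 * V (demote s′ (suc j)) (suc j)
    into-active onⱼ = demote-active-occupancy s′ j onⱼ V≡2^j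
                        (halfFull-voidAt-≢ s (suc j) p (halfFull inv j) (≢-sym 1+n≢n) onⱼ)
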